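{- Let $\sigma$ be a signature, $\Gamma\subseteq\mathcal{L}(\sigma)$ and $\phi\in\mathcal{L}(\sigma)$. If $\Gamma\vdash\phi$ in $\mathsf{FOFS}$, then $\Gamma\Vdash\phi$.
   Context: Syntax. A signature $\sigma=(\sigma^\nu,\sigma^\pi,\sigma^\alpha)$ consists of a countably infinite set $\sigma^\nu$ of constants, a countable set $\sigma^\pi$ of predicate symbols, and an arity map $\sigma^\alpha:\sigma^\pi\to\mathbb{N}_{>0}$. Fix a countably infinite set $V$ of variables; terms are constants or variables. Formulas: $\phi::=P(t_1,\dots,t_n)\mid s\doteq t\mid(\phi\land\phi)\mid(\phi\lor\phi)\mid(\phi\to\phi)\mid\Box\phi\mid\Diamond\phi\mid\forall x\phi\mid\exists x\phi\mid\bot$ with $n=\sigma^\alpha(P)$; $\neg\phi:=\phi\to\bot$, $\top:=\neg\bot$, $\leftrightarrow$ as usual. A sentence has no free variables; $\mathcal{L}(\sigma)$ is the set of sentences. For a one-place formula $\phi$ (exactly one free variable), $\phi(t)$ substitutes $t$ for it. The Hilbert system $\mathsf{FOFS}$ ($\phi,\psi$ sentences unless noted, $c,c_1,c_2$ constants): axioms are all substitution instances of theorems of intuitionistic propositional logic; $\Box(\phi\land\psi)\leftrightarrow(\Box\phi\land\Box\psi)$; $\Box\top$; $\Diamond(\phi\lor\psi)\leftrightarrow(\Diamond\phi\lor\Diamond\psi)$; $\neg\Diamond\bot$; $(\Diamond\phi\to\Box\psi)\to\Box(\phi\to\psi)$; $\Diamond(\phi\to\psi)\to(\Box\phi\to\Diamond\psi)$;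 $\forall x\phi(x)\to\phi(c)$; $\phi(c)\to\exists x\phi(x)$; $\forall x(\phi(x)\to\psi)\to(\exists x\phi(x)\to\psi)$ ($\phi$ one-place); $\forall x(\phi\to\psi(x))\to(\phi\to\forall x\psi(x))$ ($\psi$ one-place); $c\doteq c$; $c_1\doteq c_2\to(\phi(c_1)\to\phi(c_2))$ for modal-free one-place $\phi$. Rules: modus ponens; from $\phi(c)$ infer $\forall x\phi(x)$ ($x$ substitutable for $c$); from $\phi\to\psi$ infer $\Box\phi\to\Box\psi$ and $\Diamond\phi\to\Diamond\psi$. $\Gamma\vdash\phi$ means $\vdash\bigwedge_i\gamma_i\to\phi$ for some finite $\{\gamma_i\}\subseteq\Gamma$. Semantics. A Fischer Servi frame $(W,\preccurlyeq,R)$: $\preccurlyeq$ a partial order, $R$ a binary relation, with (FC1) $wRv$, $v\preccurlyeq v'$ imply some $w'$ with $w\preccurlyeq w'$, $w'Rv'$; (FC2) $w\preccurlyeq w'$, $wRv$ imply some $v'$ with $v\preccurlyeq v'$, $w'Rv'$. A domain system gives sets $D(w)$ with $D(w)\subseteq D(w')$ when $w\preccurlyeq w'$ or $wRw'$, and equivalence relations $\sim_w$ on $D(w)$ with $a\sim_w b$, $w\preccurlyeq w'$ implying $a\sim_{w'}b$. An $\mathsf{FOFS}$ model adds $I(c)\in\bigcap_w D(w)$ for constants and $I_w(P)\subseteq D(w)^n$ for $n$-ary $P$, monotone along $\preccurlyeq$ and closed under componentwise $\sim_w$. For $g:V\to D(w)$: atomic clauses via $I_w$ and $\sim_w$; $\land,\lor$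 pointwise; $w\Vdash_g\phi\to\psi$ iff for all $w'\succcurlyeq w$, $w'\nVdash_g\phi$ or $w'\Vdash_g\psi$; $w\Vdash_g\Box\phi$ iff for all $w'\succcurlyeq w$ and $v'$ with $w'Rv'$, $v'\Vdash_g\phi$; $w\Vdash_g\Diamond\phi$ iff some $v$ with $wRv$ has $v\Vdash_g\phi$; $w\Vdash_g\forall x\phi$ iff for all $w'\succcurlyeq w$ and $a\in D(w')$, $w'\Vdash_{g[x:=a]}\phi$; $w\Vdash_g\exists x\phi$ iff some $a\in D(w)$ gives $w\Vdash_{g[x:=a]}\phi$; $\bot$ never holds. For sentences truth is independent of $g$. $\Gamma\Vdash\phi$ means every model--world pair satisfying all of $\Gamma$ satisfies $\phi$. -}

module Defs where

open import Data.Nat using (ℕ; _>_; _≟_)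
open import Data.Product using (Σ; _×_; _,_)
open import Data.Sum using (_⊎_)
open import Data.Empty using (⊥)
open import Data.List using (List; []; _∷_)
open import Data.Vec using (Vec; map)
import Data.List.Relation.Unary.All as LAll
import Data.Vec.Relation.Unary.All as VAll
import Data.Vec.Relation.Unary.Any as VAny
open import Data.Vec.Relation.Binary.Pointwise.Inductive using (Pointwise)
open import Relation.Nullary using (¬_; yes; no)
open import Relation.Binary.PropositionalEquality using (_≡_)
open import Relation.Binary.Structures using (IsPartialOrder)
open import Function.Bundles using (_↔_; _↣_)

record Signature : Set₁ where
  field
    Const     : Set
    constInf  : Const ↔ ℕ
    Pred      : Set
    predCount : Pred ↣ ℕ
    arity     : Pred → ℕ
    arityPos  : ∀ P → arity P > 0

open Signature public

Var : Set
Var = ℕ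

module Syntax (σ : Signature) where

  data Term : Set where
    const : Const σ → Term
    var   : Var → Term

  infixr 6 _∧'_
  infixr 5 _∨'_
  infixr 4 _⇒_
  infix 7 _≐_

  data Fm : Set where
    atom  : (P : Pred σ) → Vec Term (arity σ P) → Fm
    _≐_   : Term → Term → Fm
    _∧'_  : Fm → Fm → Fm
    _∨'_  : Fm → Fm → Fm
    _⇒_   : Fm → Fm → Fm
    □     : Fm → Fm
    ◇     : Fm → Fm
    ∀'    : Var → Fm → Fm
    ∃'    : Var → Fm → Fm
    ⊥'    : Fm

  ¬' : Fm → Fm
  ¬' φ = φ ⇒ ⊥'

  ⊤' : Fm
  ⊤' = ¬' ⊥'

  _⇔_ : Fm → Fm → Fm
  φ ⇔ ψ = (φ ⇒ ψ) ∧' (ψ ⇒ φ)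

  data FreeInT (x : Var) : Term → Set where
    here : FreeInT x (var x)

  data FreeIn (x : Var) : Fm → Set where
    atom  : ∀ {P ts} → VAny.Any (FreeInT x) ts → FreeIn x (atom P ts)
    eqˡ   : ∀ {s t} → FreeInT x s → FreeIn x (s ≐ t)
    eqʳ   : ∀ {s t} → FreeInT x t → FreeIn x (s ≐ t)
    ∧ˡ    : ∀ {φ ψ} → FreeIn x φ → FreeIn x (φ ∧' ψ)
    ∧ʳ    : ∀ {φ ψ} → FreeIn x ψ → FreeIn x (φ ∧' ψ)
    ∨ˡ    : ∀ {φ ψ} → FreeIn x φ → FreeIn x (φ ∨' ψ)
    ∨ʳ    : ∀ {φ ψ} → FreeIn x ψ → FreeIn x (φ ∨' ψ)
    ⇒ˡ    : ∀ {φ ψ} → FreeIn x φ → FreeIn x (φ ⇒ ψ)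
    ⇒ʳ    : ∀ {φ ψ} → FreeIn x ψ → FreeIn x (φ ⇒ ψ)
    □     : ∀ {φ} → FreeIn x φ → FreeIn x (□ φ)
    ◇     : ∀ {φ} → FreeIn x φ → FreeIn x (◇ φ)
    ∀'    : ∀ {y φ} → ¬ (y ≡ x) → FreeIn x φ → FreeIn x (∀' y φ)
    ∃'    : ∀ {y φ} → ¬ (y ≡ x) → FreeIn x φ → FreeIn x (∃' y φ)

  Sentence : Fm → Set
  Sentence φ = ∀ x → ¬ FreeIn x φ

  OnePlace : Var → Fm → Set
  OnePlace x φ = FreeIn x φ × (∀ y → FreeIn y φ → y ≡ x)

  data OccursT (c : Const σ) : Term → Set where
    here : OccursT c (const c)

  data Occurs (c : Const σ) : Fm → Set where
    atom  : ∀ {P ts} → VAny.Any (OccursT c) ts → Occurs c (atom P ts)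
    eqˡ   : ∀ {s t} → OccursT c s → Occurs c (s ≐ t)
    eqʳ   : ∀ {s t} → OccursT c t → Occurs c (s ≐ t)
    ∧ˡ    : ∀ {φ ψ} → Occurs c φ → Occurs c (φ ∧' ψ)
    ∧ʳ    : ∀ {φ ψ} → Occurs c ψ → Occurs c (φ ∧' ψ)
    ∨ˡ    : ∀ {φ ψ} → Occurs c φ → Occurs c (φ ∨' ψ)
    ∨ʳ    : ∀ {φ ψ} → Occurs c ψ → Occurs c (φ ∨' ψ)
    ⇒ˡ    : ∀ {φ ψ} → Occurs c φ → Occurs c (φ ⇒ ψ)
    ⇒ʳ    : ∀ {φ ψ} → Occurs c ψ → Occurs c (φ ⇒ ψ)
    □     : ∀ {φ} → Occurs c φ → Occurs c (□ φ)
    ◇     : ∀ {φ} → Occurs c φ → Occurs c (◇ φ)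
    ∀'    : ∀ {y φ} → Occurs c φ → Occurs c (∀' y φ)
    ∃'    : ∀ {y φ} → Occurs c φ → Occurs c (∃' y φ)

  data ModalFree : Fm → Set where
    atom  : ∀ {P ts} → ModalFree (atom P ts)
    eq    : ∀ {s t} → ModalFree (s ≐ t)
    and   : ∀ {φ ψ} → ModalFree φ → ModalFree ψ → ModalFree (φ ∧' ψ)
    or    : ∀ {φ ψ} → ModalFree φ → ModalFree ψ → ModalFree (φ ∨' ψ)
    imp   : ∀ {φ ψ} → ModalFree φ → ModalFree ψ → ModalFree (φ ⇒ ψ)
    all   : ∀ {y φ} → ModalFree φ → ModalFree (∀' y φ)
    ex    : ∀ {y φ} → ModalFree φ → ModalFree (∃' y φ)
    bot   : ModalFree ⊥'

  -- substitution of a constant for the free occurrences of a variable: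
  -- for a one-place φ with free variable x, φ(c) is  φ [ x ≔ c ]
  substT : Var → Const σ → Term → Term
  substT x c (const d) = const d
  substT x c (var y) with y ≟ x
  ... | yes _ = const c
  ... | no _  = var y

  _[_≔_] : Fm → Var → Const σ → Fm
  atom P ts [ x ≔ c ] = atom P (map (substT x c) ts)
  (s ≐ t)   [ x ≔ c ] = substT x c s ≐ substT x c t
  (φ ∧' ψ)  [ x ≔ c ] = (φ [ x ≔ c ]) ∧' (ψ [ x ≔ c ])
  (φ ∨' ψ)  [ x ≔ c ] = (φ [ x ≔ c ]) ∨' (ψ [ x ≔ c ])
  (φ ⇒ ψ)   [ x ≔ c ] = (φ [ x ≔ c ]) ⇒ (ψ [ x ≔ c ])
  □ φ       [ x ≔ c ] = □ (φ [ x ≔ c ])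
  ◇ φ       [ x ≔ c ] = ◇ (φ [ x ≔ c ])
  ∀' y φ    [ x ≔ c ] with y ≟ x
  ... | yes _ = ∀' y φ
  ... | no _  = ∀' y (φ [ x ≔ c ])
  ∃' y φ    [ x ≔ c ] with y ≟ x
  ... | yes _ = ∃' y φ
  ... | no _  = ∃' y (φ [ x ≔ c ])
  ⊥'        [ x ≔ c ] = ⊥'

  data PFm : Set where
    pv   : ℕ → PFm
    p⊥   : PFm
    _p∧_ : PFm → PFm → PFm
    _p∨_ : PFm → PFm → PFm
    _p⇒_ : PFm → PFm → PFm

  data IPC : PFm → Set where
    K    : ∀ {p q} → IPC (p p⇒ (q p⇒ p))
    S    : ∀ {p q r} → IPC ((p p⇒ (q p⇒ r)) p⇒ ((p p⇒ q) p⇒ (p p⇒ r)))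
    ∧E₁  : ∀ {p q} → IPC ((p p∧ q) p⇒ p)
    ∧E₂  : ∀ {p q} → IPC ((p p∧ q) p⇒ q)
    ∧I   : ∀ {p q} → IPC (p p⇒ (q p⇒ (p p∧ q)))
    ∨I₁  : ∀ {p q} → IPC (p p⇒ (p p∨ q))
    ∨I₂  : ∀ {p q} → IPC (q p⇒ (p p∨ q))
    ∨E   : ∀ {p q r} → IPC ((p p⇒ r) p⇒ ((q p⇒ r) p⇒ ((p p∨ q) p⇒ r)))
    ⊥E   : ∀ {p} → IPC (p⊥ p⇒ p)
    mp   : ∀ {p q} → IPC (p p⇒ q) → IPC p → IPC q

  inst : (ℕ → Fm) → PFm → Fm
  inst s (pv n)   = s n
  inst s p⊥       = ⊥'
  inst s (p p∧ q) = inst s p ∧' inst s q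
  inst s (p p∨ q) = inst s p ∨' inst s q
  inst s (p p⇒ q) = inst s p ⇒ inst s q

  infix 2 ⊢_

  data ⊢_ : Fm → Set where
    ipc   : ∀ {θ} → IPC θ → (s : ℕ → Fm) → (∀ n → Sentence (s n)) → ⊢ inst s θ
    □∧    : ∀ {φ ψ} → Sentence φ → Sentence ψ → ⊢ □ (φ ∧' ψ) ⇔ (□ φ ∧' □ ψ)
    □⊤    : ⊢ □ ⊤'
    ◇∨    : ∀ {φ ψ} → Sentence φ → Sentence ψ → ⊢ ◇ (φ ∨' ψ) ⇔ (◇ φ ∨' ◇ ψ)
    ¬◇⊥   : ⊢ ¬' (◇ ⊥')
    FS1   : ∀ {φ ψ} → Sentence φ → Sentence ψ → ⊢ (◇ φ ⇒ □ ψ) ⇒ □ (φ ⇒ ψ)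
    FS2   : ∀ {φ ψ} → Sentence φ → Sentence ψ → ⊢ ◇ (φ ⇒ ψ) ⇒ (□ φ ⇒ ◇ ψ)
    ∀E    : ∀ {x φ} (c : Const σ) → OnePlace x φ → ⊢ ∀' x φ ⇒ (φ [ x ≔ c ])
    ∃I    : ∀ {x φ} (c : Const σ) → OnePlace x φ → ⊢ (φ [ x ≔ c ]) ⇒ ∃' x φ
    ∃E    : ∀ {x φ ψ} → OnePlace x φ → Sentence ψ →
            ⊢ ∀' x (φ ⇒ ψ) ⇒ (∃' x φ ⇒ ψ)
    ∀I    : ∀ {x φ ψ} → Sentence φ → OnePlace x ψ →
            ⊢ ∀' x (φ ⇒ ψ) ⇒ (φ ⇒ ∀' x ψ)
    refl≐ : (c : Const σ) → ⊢ const c ≐ const c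
    subst≐ : ∀ {x φ} (c₁ c₂ : Const σ) → ModalFree φ → OnePlace x φ →
             ⊢ (const c₁ ≐ const c₂) ⇒ ((φ [ x ≔ c₁ ]) ⇒ (φ [ x ≔ c₂ ]))
    MP    : ∀ {φ ψ} → ⊢ φ ⇒ ψ → ⊢ φ → ⊢ ψ
    -- from φ(c) infer ∀x φ(x), x substitutable for c: φ(x) is the result of
    -- replacing every c by x, i.e. a one-place φ with free variable x in
    -- which c does not occur.
    Gen   : ∀ {x φ} (c : Const σ) → OnePlace x φ → ¬ Occurs c φ →
            ⊢ φ [ x ≔ c ] → ⊢ ∀' x φ
    mono□ : ∀ {φ ψ} → ⊢ φ ⇒ ψ → ⊢ □ φ ⇒ □ ψ
    mono◇ : ∀ {φ ψ} → ⊢ φ ⇒ ψ → ⊢ ◇ φ ⇒ ◇ ψ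

  ⋀ : List Fm → Fm
  ⋀ []           = ⊤'
  ⋀ (γ ∷ [])     = γ
  ⋀ (γ ∷ δ ∷ γs) = γ ∧' ⋀ (δ ∷ γs)

  _⊢'_ : (Fm → Set) → Fm → Set
  Γ ⊢' φ = Σ (List Fm) λ γs → LAll.All Γ γs × (⊢ ⋀ γs ⇒ φ)

record Model (σ : Signature) : Set₁ where
  field
    W       : Set
    _≼_     : W → W → Set
    ≼-po    : IsPartialOrder _≡_ _≼_
    R       : W → W → Set
    FC1     : ∀ {w v v'} → R w v → v ≼ v' → Σ W λ w' → w ≼ w' × R w' v'
    FC2     : ∀ {w w' v} → w ≼ w' → R w v → Σ W λ v' → v ≼ v' × R w' v'
    -- domain system (domains are subsets of a carrier A)
    A       : Set
    D       : W → A → Set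
    D-≼     : ∀ {w w' a} → w ≼ w' → D w a → D w' a
    D-R     : ∀ {w w' a} → R w w' → D w a → D w' a
    _∼[_]_  : A → W → A → Set
    ∼-dom   : ∀ {w a b} → a ∼[ w ] b → D w a × D w b
    ∼-refl  : ∀ {w a} → D w a → a ∼[ w ] a
    ∼-sym   : ∀ {w a b} → a ∼[ w ] b → b ∼[ w ] a
    ∼-trans : ∀ {w a b c} → a ∼[ w ] b → b ∼[ w ] c → a ∼[ w ] c
    ∼-≼     : ∀ {w w' a b} → a ∼[ w ] b → w ≼ w' → a ∼[ w' ] b
    I       : Const σ → A
    I-dom   : ∀ c w → D w (I c)
    IP      : W → (P : Pred σ) → Vec A (arity σ P) → Set
    IP-dom  : ∀ {w P as} → IP w P as → VAll.All (D w) as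
    IP-≼    : ∀ {w w' P as} → w ≼ w' → IP w P as → IP w' P as
    IP-∼    : ∀ {w P as bs} → Pointwise (λ a b → a ∼[ w ] b) as bs →
              IP w P as → IP w P bs

module Semantics {σ : Signature} (M : Model σ) where
  open Syntax σ
  open Model M

  _[_↦_] : (Var → A) → Var → A → (Var → A)
  (g [ x ↦ a ]) y with y ≟ x
  ... | yes _ = a
  ... | no _  = g y

  ⟦_⟧ : Term → (Var → A) → A
  ⟦ const c ⟧ g = I c
  ⟦ var x ⟧   g = g x

  _⊩[_]_ : W → (Var → A) → Fm → Set
  w ⊩[ g ] atom P ts = IP w P (map (λ t → ⟦ t ⟧ g) ts)
  w ⊩[ g ] (s ≐ t)   = ⟦ s ⟧ g ∼[ w ] ⟦ t ⟧ g
  w ⊩[ g ] (φ ∧' ψ)  = (w ⊩[ g ] φ) × (w ⊩[ g ] ψ)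
  w ⊩[ g ] (φ ∨' ψ)  = (w ⊩[ g ] φ) ⊎ (w ⊩[ g ] ψ)
  w ⊩[ g ] (φ ⇒ ψ)   = ∀ w' → w ≼ w' → w' ⊩[ g ] φ → w' ⊩[ g ] ψ
  w ⊩[ g ] □ φ       = ∀ w' → w ≼ w' → ∀ v' → R w' v' → v' ⊩[ g ] φ
  w ⊩[ g ] ◇ φ       = Σ W λ v → R w v × (v ⊩[ g ] φ)
  w ⊩[ g ] ∀' x φ    = ∀ w' → w ≼ w' → ∀ a → D w' a → w' ⊩[ g [ x ↦ a ] ] φ
  w ⊩[ g ] ∃' x φ    = Σ A λ a → D w a × (w ⊩[ g [ x ↦ a ] ] φ)
  w ⊩[ g ] ⊥'        = ⊥

  _⊩_ : W → Fm → Set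
  w ⊩ φ = ∀ (g : Var → A) → (∀ x → D w (g x)) → w ⊩[ g ] φ

_⊨_ : {σ : Signature} → (Syntax.Fm σ → Set) → Syntax.Fm σ → Set₁
_⊨_ {σ} Γ φ = (M : Model σ) (w : Model.W M) →
  (∀ γ → Γ γ → Semantics._⊩_ M w γ) → Semantics._⊩_ M w φ

-- Soundness is proved by induction on derivations, but for a satisfaction relation that
-- also varies the interpretation J of the constants, subject only to J c lying in the
-- domain of the current world. This is forced by the rule Gen: to validate ∀x φ at a later
-- world w' and an element a of D(w'), one reinterprets the fresh constant c as a, which is
-- admissible at w' and its successors but not necessarily in the whole model. The
-- Fischer Servi conditions are exactly what the modal axioms need: FC2 makes ◇ persistent
-- and validates FS2, FC1 validates FS1.

module Submission where

open import Defs
open import Data.Nat using (_≟_)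
open import Data.Product using (Σ; _×_; _,_; proj₁; proj₂)
open import Data.Sum using (_⊎_; inj₁; inj₂)
open import Data.Empty using (⊥; ⊥-elim)
open import Data.List using ([]; _∷_)
open import Data.Vec using (Vec; map; []; _∷_)
open import Data.Vec.Properties using (map-cong; map-∘)
import Data.List.Relation.Unary.All as LAll
import Data.Vec.Relation.Unary.Any as VAny
import Data.Vec.Relation.Binary.Pointwise.Inductive as Pointwise
open import Function.Properties.Inverse using (↔⇒↣)
open import Function using (_∘_)
open import Relation.Nullary using (¬_; yes; no)
open import Relation.Nullary.Decidable using (via-injection)
open import Relation.Binary.Definitions using (DecidableEquality)
open import Relation.Binary.PropositionalEquality
  using (_≡_; _≢_; _≗_; refl; sym; trans; cong; cong₂; subst; subst₂)
open import Relation.Binary.Structures using (IsPartialOrder)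

module Soundness (σ : Signature) (M : Model σ) where
  open Syntax σ
  open Model M
  open Semantics M
  open IsPartialOrder ≼-po public using () renaming (refl to ≼-refl; trans to ≼-trans)

  _≟ᶜ_ : DecidableEquality (Const σ)
  _≟ᶜ_ = via-injection (↔⇒↣ (constInf σ)) _≟_

  ConstInterp : Set
  ConstInterp = Const σ → A

  InDomain : ∀ {X : Set} → W → (X → A) → Set
  InDomain {X} w f = ∀ (i : X) → D w (f i)

  InDomain-≼ : ∀ {X : Set} {w w'} {f : X → A} → w ≼ w' → InDomain w f → InDomain w' f
  InDomain-≼ w≼w' f∈D i = D-≼ w≼w' (f∈D i)

  InDomain-≼R : ∀ {X : Set} {w w' v} {f : X → A} → w ≼ w' → R w' v → InDomain w f → InDomain v f
  InDomain-≼R w≼w' w'Rv f∈D i = D-R w'Rv (D-≼ w≼w' (f∈D i))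

  eval : ConstInterp → (Var → A) → Term → A
  eval J g (const c) = J c
  eval J g (var x)   = g x

  _⊩⟨_⟩[_]_ : W → ConstInterp → (Var → A) → Fm → Set
  w ⊩⟨ J ⟩[ g ] atom P ts = IP w P (map (eval J g) ts)
  w ⊩⟨ J ⟩[ g ] (s ≐ t)   = eval J g s ∼[ w ] eval J g t
  w ⊩⟨ J ⟩[ g ] (φ ∧' ψ)  = w ⊩⟨ J ⟩[ g ] φ × w ⊩⟨ J ⟩[ g ] ψ
  w ⊩⟨ J ⟩[ g ] (φ ∨' ψ)  = w ⊩⟨ J ⟩[ g ] φ ⊎ w ⊩⟨ J ⟩[ g ] ψ
  w ⊩⟨ J ⟩[ g ] (φ ⇒ ψ)   = ∀ w' → w ≼ w' → w' ⊩⟨ J ⟩[ g ] φ → w' ⊩⟨ J ⟩[ g ] ψ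
  w ⊩⟨ J ⟩[ g ] □ φ       = ∀ w' → w ≼ w' → ∀ v' → R w' v' → v' ⊩⟨ J ⟩[ g ] φ
  w ⊩⟨ J ⟩[ g ] ◇ φ       = Σ W λ v → R w v × v ⊩⟨ J ⟩[ g ] φ
  w ⊩⟨ J ⟩[ g ] ∀' x φ    = ∀ w' → w ≼ w' → ∀ a → D w' a → w' ⊩⟨ J ⟩[ g [ x ↦ a ] ] φ
  w ⊩⟨ J ⟩[ g ] ∃' x φ    = Σ A λ a → D w a × w ⊩⟨ J ⟩[ g [ x ↦ a ] ] φ
  w ⊩⟨ J ⟩[ g ] ⊥'        = ⊥

  ⊩-mono : ∀ φ {w w' J g} → w ≼ w' → w ⊩⟨ J ⟩[ g ] φ → w' ⊩⟨ J ⟩[ g ] φ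
  ⊩-mono (atom P ts) w≼w' sat               = IP-≼ w≼w' sat
  ⊩-mono (s ≐ t)     w≼w' sat               = ∼-≼ sat w≼w'
  ⊩-mono (φ ∧' ψ)    w≼w' (sφ , sψ)         = ⊩-mono φ w≼w' sφ , ⊩-mono ψ w≼w' sψ
  ⊩-mono (φ ∨' ψ)    w≼w' (inj₁ sφ)         = inj₁ (⊩-mono φ w≼w' sφ)
  ⊩-mono (φ ∨' ψ)    w≼w' (inj₂ sψ)         = inj₂ (⊩-mono ψ w≼w' sψ)
  ⊩-mono (φ ⇒ ψ)     w≼w' sat w'' w'≼w''    = sat w'' (≼-trans w≼w' w'≼w'')
  ⊩-mono (□ φ)       w≼w' sat w'' w'≼w''    = sat w'' (≼-trans w≼w' w'≼w'')
  ⊩-mono (◇ φ)       w≼w' (v , wRv , sat)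
    with v' , v≼v' , w'Rv' ← FC2 w≼w' wRv  = v' , w'Rv' , ⊩-mono φ v≼v' sat
  ⊩-mono (∀' x φ)    w≼w' sat w'' w'≼w''    = sat w'' (≼-trans w≼w' w'≼w'')
  ⊩-mono (∃' x φ)    w≼w' (a , a∈D , sat)   = a , D-≼ w≼w' a∈D , ⊩-mono φ w≼w' sat

  [↦]-same : ∀ (g : Var → A) x a → (g [ x ↦ a ]) x ≡ a
  [↦]-same g x a with x ≟ x
  ... | yes _  = refl
  ... | no x≢x = ⊥-elim (x≢x refl)

  [↦]-other : ∀ (g : Var → A) {x} a {z} → z ≢ x → (g [ x ↦ a ]) z ≡ g z
  [↦]-other g {x} a {z} z≢x with z ≟ x
  ... | yes z≡x = ⊥-elim (z≢x z≡x)
  ... | no _    = refl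

  [↦]-shadow : ∀ (g : Var → A) x a b → (g [ x ↦ b ]) [ x ↦ a ] ≗ g [ x ↦ a ]
  [↦]-shadow g x a b z with z ≟ x
  ... | yes _   = refl
  ... | no z≢x  = [↦]-other g b z≢x

  [↦]-comm : ∀ (g : Var → A) {x y} a b → y ≢ x →
             (g [ y ↦ a ]) [ x ↦ b ] ≗ (g [ x ↦ b ]) [ y ↦ a ]
  [↦]-comm g {x} {y} a b y≢x z with z ≟ x | z ≟ y
  ... | yes z≡x | yes z≡y = ⊥-elim (y≢x (trans (sym z≡y) z≡x))
  ... | yes refl | no _   = sym ([↦]-same g z b)
  ... | no _ | yes refl   = [↦]-same g z a
  ... | no z≢x | no z≢y   = trans ([↦]-other g a z≢y) (sym ([↦]-other g b z≢x))

  [↦]-agree : ∀ {g g' : Var → A} {P : Var → Set} x a → (∀ {z} → x ≢ z → P z → g z ≡ g' z) →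
              ∀ {z} → P z → (g [ x ↦ a ]) z ≡ (g' [ x ↦ a ]) z
  [↦]-agree x a agree {z} pz with z ≟ x
  ... | yes _  = refl
  ... | no z≢x = agree (z≢x ∘ sym) pz

  eval-agree : ∀ t {J J' g g'} → (∀ {c} → OccursT c t → J c ≡ J' c) →
             (∀ {x} → FreeInT x t → g x ≡ g' x) → eval J g t ≡ eval J' g' t
  eval-agree (const c) agreeᶜ _ = agreeᶜ here
  eval-agree (var x)   _ agreeᵛ = agreeᵛ here

  map-eval-agree : ∀ {n} (ts : Vec Term n) {J J' : ConstInterp} {g g' : Var → A} →
                 (∀ {c} → VAny.Any (OccursT c) ts → J c ≡ J' c) →
                 (∀ {x} → VAny.Any (FreeInT x) ts → g x ≡ g' x) →
                 map (eval J g) ts ≡ map (eval J' g') ts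
  map-eval-agree []       _ _ = refl
  map-eval-agree (t ∷ ts) agreeᶜ agreeᵛ =
    cong₂ _∷_ (eval-agree t (agreeᶜ ∘ VAny.here) (agreeᵛ ∘ VAny.here))
              (map-eval-agree ts (agreeᶜ ∘ VAny.there) (agreeᵛ ∘ VAny.there))

  ⊩-agree : ∀ φ {w J J' g g'} → (∀ {c} → Occurs c φ → J c ≡ J' c) →
            (∀ {x} → FreeIn x φ → g x ≡ g' x) → w ⊩⟨ J ⟩[ g ] φ → w ⊩⟨ J' ⟩[ g' ] φ
  ⊩-agree (atom P ts) {w} agreeᶜ agreeᵛ =
    subst (IP w P) (map-eval-agree ts (agreeᶜ ∘ atom) (agreeᵛ ∘ atom))
  ⊩-agree (s ≐ t) {w} agreeᶜ agreeᵛ =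
    subst₂ _∼[ w ]_ (eval-agree s (agreeᶜ ∘ eqˡ) (agreeᵛ ∘ eqˡ))
                    (eval-agree t (agreeᶜ ∘ eqʳ) (agreeᵛ ∘ eqʳ))
  ⊩-agree (φ ∧' ψ) agreeᶜ agreeᵛ (sφ , sψ) =
    ⊩-agree φ (agreeᶜ ∘ ∧ˡ) (agreeᵛ ∘ ∧ˡ) sφ , ⊩-agree ψ (agreeᶜ ∘ ∧ʳ) (agreeᵛ ∘ ∧ʳ) sψ
  ⊩-agree (φ ∨' ψ) agreeᶜ agreeᵛ (inj₁ sφ) = inj₁ (⊩-agree φ (agreeᶜ ∘ ∨ˡ) (agreeᵛ ∘ ∨ˡ) sφ)
  ⊩-agree (φ ∨' ψ) agreeᶜ agreeᵛ (inj₂ sψ) = inj₂ (⊩-agree ψ (agreeᶜ ∘ ∨ʳ) (agreeᵛ ∘ ∨ʳ) sψ)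
  ⊩-agree (φ ⇒ ψ) agreeᶜ agreeᵛ sat w' w≼w' sφ =
    ⊩-agree ψ (agreeᶜ ∘ ⇒ʳ) (agreeᵛ ∘ ⇒ʳ)
      (sat w' w≼w' (⊩-agree φ (sym ∘ agreeᶜ ∘ ⇒ˡ) (sym ∘ agreeᵛ ∘ ⇒ˡ) sφ))
  ⊩-agree (□ φ) agreeᶜ agreeᵛ sat w' w≼w' v' w'Rv' =
    ⊩-agree φ (agreeᶜ ∘ □) (agreeᵛ ∘ □) (sat w' w≼w' v' w'Rv')
  ⊩-agree (◇ φ) agreeᶜ agreeᵛ (v , wRv , sat) =
    v , wRv , ⊩-agree φ (agreeᶜ ∘ ◇) (agreeᵛ ∘ ◇) sat
  ⊩-agree (∀' y φ) agreeᶜ agreeᵛ sat w' w≼w' a a∈D =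
    ⊩-agree φ (agreeᶜ ∘ ∀') ([↦]-agree y a (λ y≢x → agreeᵛ ∘ ∀' y≢x)) (sat w' w≼w' a a∈D)
  ⊩-agree (∃' y φ) agreeᶜ agreeᵛ (a , a∈D , sat) =
    a , a∈D , ⊩-agree φ (agreeᶜ ∘ ∃') ([↦]-agree y a (λ y≢x → agreeᵛ ∘ ∃' y≢x)) sat

  ⊩-resp-≗ : ∀ φ {w J g g'} → g ≗ g' → w ⊩⟨ J ⟩[ g ] φ → w ⊩⟨ J ⟩[ g' ] φ
  ⊩-resp-≗ φ g≗g' = ⊩-agree φ (λ _ → refl) (λ {x} _ → g≗g' x)

  ⊩-sentence : ∀ φ {w J g g'} → Sentence φ → w ⊩⟨ J ⟩[ g ] φ → w ⊩⟨ J ⟩[ g' ] φ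
  ⊩-sentence φ closed = ⊩-agree φ (λ _ → refl) (λ {x} free → ⊥-elim (closed x free))

  eval-substT : ∀ {J g} x c t → eval J g (substT x c t) ≡ eval J (g [ x ↦ J c ]) t
  eval-substT x c (const d) = refl
  eval-substT x c (var y) with y ≟ x
  ... | yes _ = refl
  ... | no _  = refl

  map-eval-substT : ∀ {J g n} x c (ts : Vec Term n) →
                    map (eval J g) (map (substT x c) ts) ≡ map (eval J (g [ x ↦ J c ])) ts
  map-eval-substT {J} {g} x c ts =
    trans (sym (map-∘ (eval J g) (substT x c) ts)) (map-cong (eval-substT x c) ts)

  ⊩-subst⁺ : ∀ φ x c {w J g} → w ⊩⟨ J ⟩[ g [ x ↦ J c ] ] φ → w ⊩⟨ J ⟩[ g ] (φ [ x ≔ c ])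
  ⊩-subst⁻ : ∀ φ x c {w J g} → w ⊩⟨ J ⟩[ g ] (φ [ x ≔ c ]) → w ⊩⟨ J ⟩[ g [ x ↦ J c ] ] φ

  ⊩-subst⁺ (atom P ts) x c {w} sat = subst (IP w P) (sym (map-eval-substT x c ts)) sat
  ⊩-subst⁺ (s ≐ t) x c {w} sat =
    subst₂ _∼[ w ]_ (sym (eval-substT x c s)) (sym (eval-substT x c t)) sat
  ⊩-subst⁺ (φ ∧' ψ) x c (sφ , sψ) = ⊩-subst⁺ φ x c sφ , ⊩-subst⁺ ψ x c sψ
  ⊩-subst⁺ (φ ∨' ψ) x c (inj₁ sφ) = inj₁ (⊩-subst⁺ φ x c sφ)
  ⊩-subst⁺ (φ ∨' ψ) x c (inj₂ sψ) = inj₂ (⊩-subst⁺ ψ x c sψ)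
  ⊩-subst⁺ (φ ⇒ ψ) x c sat w' w≼w' sφ = ⊩-subst⁺ ψ x c (sat w' w≼w' (⊩-subst⁻ φ x c sφ))
  ⊩-subst⁺ (□ φ) x c sat w' w≼w' v' w'Rv' = ⊩-subst⁺ φ x c (sat w' w≼w' v' w'Rv')
  ⊩-subst⁺ (◇ φ) x c (v , wRv , sat) = v , wRv , ⊩-subst⁺ φ x c sat
  ⊩-subst⁺ (∀' y φ) x c {J = J} {g} sat with y ≟ x
  ... | yes refl = λ w' w≼w' a a∈D → ⊩-resp-≗ φ ([↦]-shadow g y a (J c)) (sat w' w≼w' a a∈D)
  ... | no y≢x   = λ w' w≼w' a a∈D →
    ⊩-subst⁺ φ x c (⊩-resp-≗ φ (sym ∘ [↦]-comm g a (J c) y≢x) (sat w' w≼w' a a∈D))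
  ⊩-subst⁺ (∃' y φ) x c {J = J} {g} (a , a∈D , sat) with y ≟ x
  ... | yes refl = a , a∈D , ⊩-resp-≗ φ ([↦]-shadow g y a (J c)) sat
  ... | no y≢x   = a , a∈D , ⊩-subst⁺ φ x c (⊩-resp-≗ φ (sym ∘ [↦]-comm g a (J c) y≢x) sat)

  ⊩-subst⁻ (atom P ts) x c {w} sat = subst (IP w P) (map-eval-substT x c ts) sat
  ⊩-subst⁻ (s ≐ t) x c {w} sat = subst₂ _∼[ w ]_ (eval-substT x c s) (eval-substT x c t) sat
  ⊩-subst⁻ (φ ∧' ψ) x c (sφ , sψ) = ⊩-subst⁻ φ x c sφ , ⊩-subst⁻ ψ x c sψ
  ⊩-subst⁻ (φ ∨' ψ) x c (inj₁ sφ) = inj₁ (⊩-subst⁻ φ x c sφ)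
  ⊩-subst⁻ (φ ∨' ψ) x c (inj₂ sψ) = inj₂ (⊩-subst⁻ ψ x c sψ)
  ⊩-subst⁻ (φ ⇒ ψ) x c sat w' w≼w' sφ = ⊩-subst⁻ ψ x c (sat w' w≼w' (⊩-subst⁺ φ x c sφ))
  ⊩-subst⁻ (□ φ) x c sat w' w≼w' v' w'Rv' = ⊩-subst⁻ φ x c (sat w' w≼w' v' w'Rv')
  ⊩-subst⁻ (◇ φ) x c (v , wRv , sat) = v , wRv , ⊩-subst⁻ φ x c sat
  ⊩-subst⁻ (∀' y φ) x c {J = J} {g} sat with y ≟ x
  ... | yes refl = λ w' w≼w' a a∈D →
    ⊩-resp-≗ φ (sym ∘ [↦]-shadow g y a (J c)) (sat w' w≼w' a a∈D)
  ... | no y≢x   = λ w' w≼w' a a∈D →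
    ⊩-resp-≗ φ ([↦]-comm g a (J c) y≢x) (⊩-subst⁻ φ x c (sat w' w≼w' a a∈D))
  ⊩-subst⁻ (∃' y φ) x c sat with y ≟ x
  ⊩-subst⁻ (∃' y φ) x c {J = J} {g} (a , a∈D , sat) | yes refl =
    a , a∈D , ⊩-resp-≗ φ (sym ∘ [↦]-shadow g y a (J c)) sat
  ⊩-subst⁻ (∃' y φ) x c {J = J} {g} (a , a∈D , sat) | no y≢x =
    a , a∈D , ⊩-resp-≗ φ ([↦]-comm g a (J c) y≢x) (⊩-subst⁻ φ x c sat)

  eval-resp-∼ : ∀ t {w J g h} → InDomain w J → (∀ x → g x ∼[ w ] h x) →
                eval J g t ∼[ w ] eval J h t
  eval-resp-∼ (const c) J∈D _   = ∼-refl (J∈D c)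
  eval-resp-∼ (var x)   _   g∼h = g∼h x

  [↦]-resp-∼ : ∀ {w} {g h : Var → A} x {a b} → a ∼[ w ] b → (∀ z → g z ∼[ w ] h z) →
               ∀ z → (g [ x ↦ a ]) z ∼[ w ] (h [ x ↦ b ]) z
  [↦]-resp-∼ x a∼b g∼h z with z ≟ x
  ... | yes _ = a∼b
  ... | no _  = g∼h z

  ⊩-resp-∼ : ∀ φ → ModalFree φ → ∀ {w J g h} → InDomain w J → (∀ x → g x ∼[ w ] h x) →
             w ⊩⟨ J ⟩[ g ] φ → w ⊩⟨ J ⟩[ h ] φ
  ⊩-resp-∼ (atom P ts) atom J∈D g∼h =
    IP-∼ (Pointwise.map⁺ (λ { {t} refl → eval-resp-∼ t J∈D g∼h }) (Pointwise.refl {_∼_ = _≡_} refl))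
  ⊩-resp-∼ (s ≐ t) eq J∈D g∼h s∼t =
    ∼-trans (∼-sym (eval-resp-∼ s J∈D g∼h)) (∼-trans s∼t (eval-resp-∼ t J∈D g∼h))
  ⊩-resp-∼ (φ ∧' ψ) (and mφ mψ) J∈D g∼h (sφ , sψ) =
    ⊩-resp-∼ φ mφ J∈D g∼h sφ , ⊩-resp-∼ ψ mψ J∈D g∼h sψ
  ⊩-resp-∼ (φ ∨' ψ) (or mφ mψ) J∈D g∼h (inj₁ sφ) = inj₁ (⊩-resp-∼ φ mφ J∈D g∼h sφ)
  ⊩-resp-∼ (φ ∨' ψ) (or mφ mψ) J∈D g∼h (inj₂ sψ) = inj₂ (⊩-resp-∼ ψ mψ J∈D g∼h sψ)
  ⊩-resp-∼ (φ ⇒ ψ) (imp mφ mψ) J∈D g∼h sat w' w≼w' sφ =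
    ⊩-resp-∼ ψ mψ (InDomain-≼ w≼w' J∈D) (λ x → ∼-≼ (g∼h x) w≼w')
      (sat w' w≼w' (⊩-resp-∼ φ mφ (InDomain-≼ w≼w' J∈D) (λ x → ∼-sym (∼-≼ (g∼h x) w≼w')) sφ))
  ⊩-resp-∼ (∀' x φ) (all m) J∈D g∼h sat w' w≼w' a a∈D =
    ⊩-resp-∼ φ m (InDomain-≼ w≼w' J∈D)
      ([↦]-resp-∼ x (∼-refl a∈D) (λ z → ∼-≼ (g∼h z) w≼w')) (sat w' w≼w' a a∈D)
  ⊩-resp-∼ (∃' x φ) (ex m) J∈D g∼h (a , a∈D , sat) =
    a , a∈D , ⊩-resp-∼ φ m J∈D ([↦]-resp-∼ x (∼-refl a∈D) g∼h) sat

  IPC-valid : ∀ {θ} → IPC θ → ∀ s {w J g} → w ⊩⟨ J ⟩[ g ] inst s θ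
  IPC-valid (K {p}) s _ _ sp w' w≼w' _ = ⊩-mono (inst s p) w≼w' sp
  IPC-valid S s _ _ spqr _ w≼w' spq w'' w'≼w'' sp =
    spqr w'' (≼-trans w≼w' w'≼w'') sp w'' ≼-refl (spq w'' w'≼w'' sp)
  IPC-valid ∧E₁ s _ _ = proj₁
  IPC-valid ∧E₂ s _ _ = proj₂
  IPC-valid (∧I {p}) s _ _ sp w' w≼w' sq = ⊩-mono (inst s p) w≼w' sp , sq
  IPC-valid ∨I₁ s _ _ = inj₁
  IPC-valid ∨I₂ s _ _ = inj₂
  IPC-valid ∨E s _ _ spr _ w≼w' sqr w'' w'≼w'' (inj₁ sp) = spr w'' (≼-trans w≼w' w'≼w'') sp
  IPC-valid ∨E s _ _ spr _ w≼w' sqr w'' w'≼w'' (inj₂ sq) = sqr w'' w'≼w'' sq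
  IPC-valid ⊥E s _ _ ()
  IPC-valid (mp ⊢p⇒q ⊢p) s {w} = IPC-valid ⊢p⇒q s w ≼-refl (IPC-valid ⊢p s)

  FS1-valid : ∀ φ ψ {w J g} → w ⊩⟨ J ⟩[ g ] ((◇ φ ⇒ □ ψ) ⇒ □ (φ ⇒ ψ))
  FS1-valid _ _ _ _ ◇φ⇒□ψ w' w₁≼w' v w'Rv v' v≼v' sφ
    with w'' , w'≼w'' , w''Rv' ← FC1 w'Rv v≼v' =
    ◇φ⇒□ψ w'' (≼-trans w₁≼w' w'≼w'') (v' , w''Rv' , sφ) w'' ≼-refl v' w''Rv'

  FS2-valid : ∀ φ ψ {w J g} → w ⊩⟨ J ⟩[ g ] (◇ (φ ⇒ ψ) ⇒ (□ φ ⇒ ◇ ψ))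
  FS2-valid _ _ _ _ (v , w₁Rv , φ⇒ψ) w' w₁≼w' □φ
    with v' , v≼v' , w'Rv' ← FC2 w₁≼w' w₁Rv =
    v' , w'Rv' , φ⇒ψ v' v≼v' (□φ w' ≼-refl v' w'Rv')

  subst≐-valid : ∀ {x φ w J g} (c₁ c₂ : Const σ) → ModalFree φ → InDomain w J → InDomain w g →
                 w ⊩⟨ J ⟩[ g ] (const c₁ ≐ const c₂ ⇒ (φ [ x ≔ c₁ ] ⇒ φ [ x ≔ c₂ ]))
  subst≐-valid {x} {φ} {w} c₁ c₂ modalFree J∈D g∈D w' w≼w' c₁∼c₂ w'' w'≼w'' sφc₁ =
    ⊩-subst⁺ φ x c₂
      (⊩-resp-∼ φ modalFree (InDomain-≼ w≼w'' J∈D)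
        ([↦]-resp-∼ x (∼-≼ c₁∼c₂ w'≼w'') (λ z → ∼-refl (InDomain-≼ w≼w'' g∈D z)))
        (⊩-subst⁻ φ x c₁ sφc₁))
    where
    w≼w'' : w ≼ w''
    w≼w'' = ≼-trans w≼w' w'≼w''

  _[_↦ᶜ_] : ConstInterp → Const σ → A → ConstInterp
  (J [ c ↦ᶜ a ]) d with d ≟ᶜ c
  ... | yes _ = a
  ... | no _  = J d

  [↦ᶜ]-same : ∀ J c a → (J [ c ↦ᶜ a ]) c ≡ a
  [↦ᶜ]-same J c a with c ≟ᶜ c
  ... | yes _  = refl
  ... | no c≢c = ⊥-elim (c≢c refl)

  [↦ᶜ]-other : ∀ J {c} a {d} → d ≢ c → (J [ c ↦ᶜ a ]) d ≡ J d
  [↦ᶜ]-other J {c} a {d} d≢c with d ≟ᶜ c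
  ... | yes d≡c = ⊥-elim (d≢c d≡c)
  ... | no _    = refl

  InDomain-[↦ᶜ] : ∀ {w J c a} → InDomain w J → D w a → InDomain w (J [ c ↦ᶜ a ])
  InDomain-[↦ᶜ] {c = c} J∈D a∈D d with d ≟ᶜ c
  ... | yes _ = a∈D
  ... | no _  = J∈D d

  Gen-sound : ∀ {x φ} c → ¬ Occurs c φ →
              (∀ {w J g} → InDomain w J → InDomain w g → w ⊩⟨ J ⟩[ g ] (φ [ x ≔ c ])) →
              ∀ {w J g} → InDomain w J → InDomain w g → w ⊩⟨ J ⟩[ g ] ∀' x φ
  Gen-sound {x} {φ} c c∉φ φc-valid {J = J} {g} J∈D g∈D w' w≼w' a a∈D =
    ⊩-agree φ unchanged-on-φ (λ {z} _ → cong (λ b → (g [ x ↦ b ]) z) ([↦ᶜ]-same J c a))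
      (⊩-subst⁻ φ x c
        (φc-valid (InDomain-[↦ᶜ] (InDomain-≼ w≼w' J∈D) a∈D) (InDomain-≼ w≼w' g∈D)))
    where
    unchanged-on-φ : ∀ {d} → Occurs d φ → (J [ c ↦ᶜ a ]) d ≡ J d
    unchanged-on-φ d∈φ = [↦ᶜ]-other J a (λ d≡c → c∉φ (subst (λ k → Occurs k φ) d≡c d∈φ))

  soundness : ∀ {φ} → ⊢ φ → ∀ {w J g} → InDomain w J → InDomain w g → w ⊩⟨ J ⟩[ g ] φ
  soundness (ipc ⊢θ s _) _ _ = IPC-valid ⊢θ s
  soundness (□∧ _ _) _ _ =
    (λ _ _ □φ∧ψ → (λ w' w≼w' v r → proj₁ (□φ∧ψ w' w≼w' v r)) ,
                  (λ w' w≼w' v r → proj₂ (□φ∧ψ w' w≼w' v r))) ,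
    (λ { _ _ (□φ , □ψ) w' w≼w' v r → □φ w' w≼w' v r , □ψ w' w≼w' v r })
  soundness □⊤ _ _ _ _ _ _ _ _ ⊥-holds = ⊥-holds
  soundness (◇∨ _ _) _ _ =
    (λ { _ _ (v , r , inj₁ sφ) → inj₁ (v , r , sφ) ; _ _ (v , r , inj₂ sψ) → inj₂ (v , r , sψ) }) ,
    (λ { _ _ (inj₁ (v , r , sφ)) → v , r , inj₁ sφ ; _ _ (inj₂ (v , r , sψ)) → v , r , inj₂ sψ })
  soundness ¬◇⊥ _ _ _ _ (_ , _ , ())
  soundness (FS1 {φ} {ψ} _ _) _ _ = FS1-valid φ ψ
  soundness (FS2 {φ} {ψ} _ _) _ _ = FS2-valid φ ψ
  soundness (∀E {x} {φ} c _) J∈D _ w' w≼w' ∀φ =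
    ⊩-subst⁺ φ x c (∀φ w' ≼-refl _ (InDomain-≼ w≼w' J∈D c))
  soundness (∃I {x} {φ} c _) J∈D _ w' w≼w' sφc =
    _ , InDomain-≼ w≼w' J∈D c , ⊩-subst⁻ φ x c sφc
  soundness (∃E {ψ = ψ} _ ψ-closed) _ _ _ _ ∀φ⇒ψ w' w≼w' (a , a∈D , sφ) =
    ⊩-sentence ψ ψ-closed (∀φ⇒ψ w' w≼w' a a∈D w' ≼-refl sφ)
  soundness (∀I {φ = φ} φ-closed _) _ _ _ _ ∀φ⇒ψ w' w≼w' sφ w'' w'≼w'' a a∈D =
    ∀φ⇒ψ w'' (≼-trans w≼w' w'≼w'') a a∈D w'' ≼-refl (⊩-sentence φ φ-closed (⊩-mono φ w'≼w'' sφ))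
  soundness (refl≐ c) J∈D _ = ∼-refl (J∈D c)
  soundness (subst≐ c₁ c₂ modalFree _) = subst≐-valid c₁ c₂ modalFree
  soundness (MP ⊢φ⇒ψ ⊢φ) J∈D g∈D = soundness ⊢φ⇒ψ J∈D g∈D _ ≼-refl (soundness ⊢φ J∈D g∈D)
  soundness (Gen c _ c∉φ ⊢φc) = Gen-sound c c∉φ (soundness ⊢φc)
  soundness (mono□ ⊢φ⇒ψ) {w} J∈D g∈D _ w≼w' □φ w'' w'≼w'' v w''Rv =
    soundness ⊢φ⇒ψ (InDomain-≼R w≼w'' w''Rv J∈D) (InDomain-≼R w≼w'' w''Rv g∈D) v ≼-refl
      (□φ w'' w'≼w'' v w''Rv)
    where
    w≼w'' : w ≼ w''
    w≼w'' = ≼-trans w≼w' w'≼w''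
  soundness (mono◇ ⊢φ⇒ψ) J∈D g∈D _ w≼w' (v , w'Rv , sφ) =
    v , w'Rv ,
    soundness ⊢φ⇒ψ (InDomain-≼R w≼w' w'Rv J∈D) (InDomain-≼R w≼w' w'Rv g∈D) v ≼-refl sφ

  eval-I : ∀ g t → eval I g t ≡ ⟦ t ⟧ g
  eval-I g (const c) = refl
  eval-I g (var x)   = refl

  ⊩⟨I⟩⇒⊩ : ∀ φ {w g} → w ⊩⟨ I ⟩[ g ] φ → w ⊩[ g ] φ
  ⊩⇒⊩⟨I⟩ : ∀ φ {w g} → w ⊩[ g ] φ → w ⊩⟨ I ⟩[ g ] φ

  ⊩⟨I⟩⇒⊩ (atom P ts) {w} {g} = subst (IP w P) (map-cong (eval-I g) ts)
  ⊩⟨I⟩⇒⊩ (s ≐ t) {w} {g} = subst₂ _∼[ w ]_ (eval-I g s) (eval-I g t)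
  ⊩⟨I⟩⇒⊩ (φ ∧' ψ) (sφ , sψ) = ⊩⟨I⟩⇒⊩ φ sφ , ⊩⟨I⟩⇒⊩ ψ sψ
  ⊩⟨I⟩⇒⊩ (φ ∨' ψ) (inj₁ sφ) = inj₁ (⊩⟨I⟩⇒⊩ φ sφ)
  ⊩⟨I⟩⇒⊩ (φ ∨' ψ) (inj₂ sψ) = inj₂ (⊩⟨I⟩⇒⊩ ψ sψ)
  ⊩⟨I⟩⇒⊩ (φ ⇒ ψ) sat w' w≼w' sφ = ⊩⟨I⟩⇒⊩ ψ (sat w' w≼w' (⊩⇒⊩⟨I⟩ φ sφ))
  ⊩⟨I⟩⇒⊩ (□ φ) sat w' w≼w' v' w'Rv' = ⊩⟨I⟩⇒⊩ φ (sat w' w≼w' v' w'Rv')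
  ⊩⟨I⟩⇒⊩ (◇ φ) (v , wRv , sat) = v , wRv , ⊩⟨I⟩⇒⊩ φ sat
  ⊩⟨I⟩⇒⊩ (∀' x φ) sat w' w≼w' a a∈D = ⊩⟨I⟩⇒⊩ φ (sat w' w≼w' a a∈D)
  ⊩⟨I⟩⇒⊩ (∃' x φ) (a , a∈D , sat) = a , a∈D , ⊩⟨I⟩⇒⊩ φ sat

  ⊩⇒⊩⟨I⟩ (atom P ts) {w} {g} = subst (IP w P) (sym (map-cong (eval-I g) ts))
  ⊩⇒⊩⟨I⟩ (s ≐ t) {w} {g} = subst₂ _∼[ w ]_ (sym (eval-I g s)) (sym (eval-I g t))
  ⊩⇒⊩⟨I⟩ (φ ∧' ψ) (sφ , sψ) = ⊩⇒⊩⟨I⟩ φ sφ , ⊩⇒⊩⟨I⟩ ψ sψ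
  ⊩⇒⊩⟨I⟩ (φ ∨' ψ) (inj₁ sφ) = inj₁ (⊩⇒⊩⟨I⟩ φ sφ)
  ⊩⇒⊩⟨I⟩ (φ ∨' ψ) (inj₂ sψ) = inj₂ (⊩⇒⊩⟨I⟩ ψ sψ)
  ⊩⇒⊩⟨I⟩ (φ ⇒ ψ) sat w' w≼w' sφ = ⊩⇒⊩⟨I⟩ ψ (sat w' w≼w' (⊩⟨I⟩⇒⊩ φ sφ))
  ⊩⇒⊩⟨I⟩ (□ φ) sat w' w≼w' v' w'Rv' = ⊩⇒⊩⟨I⟩ φ (sat w' w≼w' v' w'Rv')
  ⊩⇒⊩⟨I⟩ (◇ φ) (v , wRv , sat) = v , wRv , ⊩⇒⊩⟨I⟩ φ sat
  ⊩⇒⊩⟨I⟩ (∀' x φ) sat w' w≼w' a a∈D = ⊩⇒⊩⟨I⟩ φ (sat w' w≼w' a a∈D)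
  ⊩⇒⊩⟨I⟩ (∃' x φ) (a , a∈D , sat) = a , a∈D , ⊩⇒⊩⟨I⟩ φ sat

  ⋀-intro : ∀ {w J g} γs → LAll.All (w ⊩⟨ J ⟩[ g ]_) γs → w ⊩⟨ J ⟩[ g ] ⋀ γs
  ⋀-intro []           _                 _ _ ()
  ⋀-intro (γ ∷ [])     (sγ LAll.∷ _)    = sγ
  ⋀-intro (γ ∷ δ ∷ γs) (sγ LAll.∷ sδγs) = sγ , ⋀-intro (δ ∷ γs) sδγs

mainTheorem2 : (σ : Signature) (Γ : Syntax.Fm σ → Set) (φ : Syntax.Fm σ) →
    (∀ γ → Γ γ → Syntax.Sentence σ γ) → Syntax.Sentence σ φ →
    Syntax._⊢'_ σ Γ φ → Γ ⊨ φ
mainTheorem2 σ Γ φ _ _ (γs , γs∈Γ , ⊢⋀γs⇒φ) M w w⊩Γ g g∈D =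
  ⊩⟨I⟩⇒⊩ φ (soundness ⊢⋀γs⇒φ I∈D g∈D w ≼-refl (⋀-intro γs (LAll.map w⊩⟨I⟩γ γs∈Γ)))
  where
  open Soundness σ M
  open Model M using (I; I-dom)

  I∈D : InDomain w I
  I∈D c = I-dom c w

  w⊩⟨I⟩γ : ∀ {γ} → Γ γ → w ⊩⟨ I ⟩[ g ] γ
  w⊩⟨I⟩γ {γ} γ∈Γ = ⊩⇒⊩⟨I⟩ γ (w⊩Γ γ γ∈Γ g g∈D)
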